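{- Let $t$, $t'$ be normalised BESsy structure graphs in which no vertex is labelled with a free variable. Assume $t$ is minimal w.r.t. strong bisimilarity. Then $t \leftrightarrow t'$ implies $[\![\varphi(t)]\!]([\![\mathrm{BES}(t)]\!]) = [\![\varphi(t')]\!]([\![\mathrm{BES}(t')]\!])$.
   Context: A structure graph $\langle T,t,\to,d,r,\nearrow\rangle$ has vertices, root $t$, edges $\to$, partial decoration $d:T\to\{\blacktriangle,\blacktriangledown,\top,\bot\}$, partial rank $r:T\to\mathbb{N}$ and partial free-variable label $\nearrow$. It is BESsy if: vertices decorated $\top,\bot$ or with a free variable have no successors; a vertex is decorated $\blacktriangle$/$\blacktriangledown$ or ranked iff it has a successor; vertices with multiple successors are decorated $\blacktriangle$ or $\blacktriangledown$; every cycle contains a ranked vertex. Normalised means every vertex with a successor is ranked. $\leftrightarrow$ is strong bisimilarity on structure graphs (related vertices have equal decoration, rank and free-variable label, and successors match). Fix a total order on variables/constants lifted to formulae; $\mathrm{Conj}(\emptyset)=\mathsf{true}$, $\mathrm{Conj}(\{f\})=f\wedge f$, $\mathrm{Conj}(\{f\}\cup F)=f\wedge\mathrm{Conj}(F)$ for $f$ smaller than all of $F$; $\mathrm{Disj}$ dually with $\mathsf{false},\vee$. $\varphi(u)$ is $\mathrm{Conj}\{\varphi(u')\mid u\to u'\}$ (resp. $\mathrm{Disj}$) if $d(u)=\blacktriangle$ (resp. $\blacktriangledown$) and $u$ unranked, $\mathsf{true}$/$\mathsf{false}$ if $d(u)=\top/\bot$, $X$ if $\nearrow(u)=X$, and a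 fresh variable $X_u$ otherwise. $\mathrm{BES}(t)$ contains, for each ranked vertex $u$, an equation $\sigma X_u = \mathrm{rhs}(u)$ ($\sigma=\mu$ iff rank odd), ordered by descending rank, where $\mathrm{rhs}(u)$ is $\mathrm{Conj}\{\varphi(u')\mid u\to u'\}$ if $d(u)=\blacktriangle$, $\mathrm{Disj}\{\varphi(u')\mid u\to u'\}$ if $d(u)=\blacktriangledown$, else $\varphi(u')$ for the unique successor; $[\![\mathrm{BES}(t)]\!]$ is its solution. -}

module Defs where

open import Data.Nat using (ℕ; zero; suc; _⊔_)
open import Data.Nat.Properties using (_≟_)
open import Data.Bool using (Bool; true; false; _∧_; _∨_; if_then_else_)
open import Data.Fin using (Fin)
open import Data.Fin.Properties using () renaming (_≟_ to _≟F_)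
open import Data.Maybe using (Maybe; just; nothing; Is-just)
open import Data.List using (List; []; _∷_; filter; concatMap; reverse; upTo; foldr; map)
open import Data.List.Relation.Unary.Any using (Any)

open import Data.List.Base using (allFin)
open import Data.Product using (Σ; ∃; _×_; _,_)
open import Data.Sum using (_⊎_)
open import Relation.Binary.PropositionalEquality using (_≡_; _≢_)
open import Relation.Nullary using (yes; no; ¬_)
open import Relation.Nullary.Decidable using (⌊_⌋)
open import Function.Bundles using (_⇔_)

-- decorations ▲ (conjunctive), ▼ (disjunctive), ⊤, ⊥
data Deco : Set where
  ▲ ▼ ⊤ᵈ ⊥ᵈ : Deco

Var : Set
Var = ℕ

record StructureGraph (n : ℕ) : Set where
  field
    root : Fin n
    _⟶_  : Fin n → Fin n → Bool
    deco : Fin n → Maybe Deco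
    rank : Fin n → Maybe ℕ
    fvar : Fin n → Maybe Var

open StructureGraph public

module _ {n : ℕ} (t : StructureGraph n) where

  Edge : Fin n → Fin n → Set
  Edge u v = (_⟶_ t u v) ≡ true

  HasSucc : Fin n → Set
  HasSucc u = ∃ λ v → Edge u v

  Ranked : Fin n → Set
  Ranked u = Is-just (rank t u)

  WalkTo : Fin n → List (Fin n) → Fin n → Set
  WalkTo u []       w = Edge u w
  WalkTo u (v ∷ vs) w = Edge u v × WalkTo v vs w

  record BESsy : Set where
    field
      sinks    : ∀ u → (deco t u ≡ just ⊤ᵈ ⊎ deco t u ≡ just ⊥ᵈ ⊎ Is-just (fvar t u))
                     → ∀ v → ¬ Edge u v
      succIff  : ∀ u → ((deco t u ≡ just ▲ ⊎ deco t u ≡ just ▼) ⊎ Ranked u) ⇔ HasSucc u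
      multi    : ∀ u v w → Edge u v → Edge u w → v ≢ w
                     → deco t u ≡ just ▲ ⊎ deco t u ≡ just ▼
      cycles   : ∀ x xs → WalkTo x xs x → Any Ranked (x ∷ xs)

  Normalised : Set
  Normalised = ∀ u → HasSucc u → Ranked u

  NoFreeVars : Set
  NoFreeVars = ∀ u → fvar t u ≡ nothing

module _ {n m : ℕ} (t : StructureGraph n) (t' : StructureGraph m) where

  IsBisimulation : (Fin n → Fin m → Set) → Set
  IsBisimulation R = ∀ u v → R u v →
      deco t u ≡ deco t' v
    × rank t u ≡ rank t' v
    × fvar t u ≡ fvar t' v
    × (∀ u' → Edge t u u' → ∃ λ v' → Edge t' v v' × R u' v')
    × (∀ v' → Edge t' v v' → ∃ λ u' → Edge t u u' × R u' v')

  Bisimilar : Fin n → Fin m → Set₁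
  Bisimilar u v = Σ (Fin n → Fin m → Set) λ R → IsBisimulation R × R u v

_↔_ : {n m : ℕ} → StructureGraph n → StructureGraph m → Set₁
t ↔ t' = Bisimilar t t' (root t) (root t')

Minimal : {n : ℕ} → StructureGraph n → Set₁
Minimal t = ∀ u v → Bisimilar t t u v → u ≡ v

-- environment for the variables X_u (one per vertex)
Env : ℕ → Set
Env n = Fin n → Bool

_[_≔_] : {n : ℕ} → Env n → Fin n → Bool → Env n
(η [ x ≔ b ]) y with ⌊ x ≟F y ⌋
... | true  = b
... | false = η y

-- fixpoints of monotone Bool → Bool maps (Kleene iteration on the
-- two-element lattice stabilises after one step)
μfix νfix : (Bool → Bool) → Bool
μfix f = f false
νfix f = f true

allL anyL : {A : Set} → (A → Bool) → List A → Bool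
allL p = foldr (λ a b → p a ∧ b) true
anyL p = foldr (λ a b → p a ∨ b) false

module Sem {n : ℕ} (t : StructureGraph n) (ζ : Var → Bool) where

  vs : List (Fin n)
  vs = allFin n

  succs : Fin n → List (Fin n)
  succs u = filter (λ v → Data.Bool._≟_ (_⟶_ t u v) true) vs

  -- ⟦φ(u)⟧η ; ζ interprets the free variables, η the variables X_u.
  -- The fuel bounds the recursion through unranked vertices (by BESsy,
  -- such paths have length < n, so fuel n suffices).
  φ-val : ℕ → Env n → Fin n → Bool
  φ-val k η u with rank t u
  ... | just _ = η u
  ... | nothing with deco t u
  ...   | just ▲ = conjK k
    where conjK : ℕ → Bool
          conjK zero    = false
          conjK (suc k) = allL (φ-val k η) (succs u)
  ...   | just ▼ = disjK k
    where disjK : ℕ → Bool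
          disjK zero    = false
          disjK (suc k) = anyL (φ-val k η) (succs u)
  ...   | just ⊤ᵈ = true
  ...   | just ⊥ᵈ = false
  ...   | nothing with fvar t u
  ...     | just X  = ζ X
  ...     | nothing = η u       -- fresh variable X_u

  φ : Env n → Fin n → Bool
  φ = φ-val n

  rhs : Env n → Fin n → Bool
  rhs η u with deco t u
  ... | just ▲ = allL (φ η) (succs u)
  ... | just ▼ = anyL (φ η) (succs u)
  ... | _ with succs u
  ...   | []     = false
  ...   | v ∷ _  = φ η v             -- the unique successor

  maxRank : ℕ
  maxRank = foldr (λ u acc → rk u ⊔ acc) 0 vs
    where rk : Fin n → ℕ
          rk u with rank t u
          ... | just k  = k
          ... | nothing = 0

  hasRank : ℕ → Fin n → Bool
  hasRank k u with rank t u
  ... | just j  = ⌊ j ≟ k ⌋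
  ... | nothing = false

  odd : ℕ → Bool
  odd zero          = false
  odd (suc zero)    = true
  odd (suc (suc k)) = odd k

  -- equations σX_u = rhs(u): (u , σ is μ) in descending order of rank
  -- (ties broken by vertex index)
  equations : List (Fin n × Bool)
  equations = concatMap (λ k → map (λ u → u , odd k)
                                   (filter (λ u → Data.Bool._≟_ (hasRank k u) true) vs))
                        (reverse (upTo (suc maxRank)))

  -- standard BES semantics:  ⟦ε⟧η = η,
  -- ⟦(σX = f) E⟧η = ⟦E⟧ η[X ≔ σ b. ⟦f⟧(⟦E⟧ η[X ≔ b])]
  solve : List (Fin n × Bool) → Env n → Env n
  solve []              η = η
  solve ((x , μ?) ∷ es) η =
    solve es (η [ x ≔ fixσ (λ b → rhs (solve es (η [ x ≔ b ])) x) ])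
    where fixσ : (Bool → Bool) → Bool
          fixσ = if μ? then μfix else νfix

  ⟦BES⟧ : Env n → Env n
  ⟦BES⟧ = solve equations

-- ⟦φ(t)⟧(⟦BES(t)⟧): ζ interprets free variables; unbound fresh
-- variables X_u (undecorated, unranked sinks) default to false.
⟦φ⟧⟦BES⟧ : {n : ℕ} → StructureGraph n → (Var → Bool) → Bool
⟦φ⟧⟦BES⟧ t ζ = Sem.φ t ζ (Sem.⟦BES⟧ t ζ (λ _ → false)) (root t)

-- The BES lists its equations rank by rank, and inside one rank in an
-- arbitrary vertex order, so the two systems cannot be compared equation
-- by equation.  We first develop nested fixpoints for an abstract
-- monotone F on Bool^n: Kleene iteration reaches a simultaneous fixpoint
-- after n+1 steps, and Bekič's principle shows that solving a block of
-- equations of equal sign one after another yields the simultaneous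
-- fixpoint of the block, whatever the order.  A Transfer lemma then
-- compares two systems along a relation R: if R respects the blocks and
-- the right-hand sides, the iterates, hence the block fixpoints, hence
-- the solutions agree on R-related variables.  Finally we instantiate
-- this with a bisimulation: since every vertex with successors is
-- ranked, φ(u) is just X_u or a constant, and Conj/Disj over R-matching
-- successors agree.

module Submission where

open import Defs
open import Data.Nat using (ℕ; zero; suc; _+_; _∸_; _<_; _≤_; z≤n; s≤s; _⊔_)
import Data.Nat.Properties as ℕₚ
open import Data.Bool using (Bool; true; false; not; _∧_; _∨_; if_then_else_) renaming (_≤_ to _≤ᵇ_)
import Data.Bool as Bool
open import Data.Bool.Base using (f≤t; b≤b)
import Data.Bool.Properties as Boolₚ
open import Data.Fin using (Fin) renaming (zero to fzero; suc to fsuc)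
open import Data.Fin.Properties using () renaming (_≟_ to _≟F_)
open import Data.List using (List; []; _∷_; _++_; map; concatMap; filter; foldr; downFrom; reverse; upTo)
import Data.List.Properties as Listₚ
open import Data.List.Membership.Propositional.Properties using (∈-filter⁺; ∈-filter⁻; ∈-allFin)
import Data.List.Relation.Unary.Unique.Propositional.Properties as Uniqueₚ
open import Data.List.Membership.Propositional using (_∈_; _∉_)
open import Data.List.Relation.Unary.Any using (here; there; any?)
import Data.List.Relation.Unary.All as All
open import Data.List.Relation.Unary.All.Properties using (All¬⇒¬Any)
open import Data.List.Relation.Unary.AllPairs using ([]; _∷_)
open import Data.List.Relation.Unary.Unique.Propositional using (Unique)
open import Data.Maybe using (Maybe; just; nothing; Is-just)
open import Data.Product using (∃; _×_; _,_; proj₁; proj₂)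
open import Data.Sum using (_⊎_; inj₁; inj₂)
open import Data.Empty using (⊥; ⊥-elim)
open import Relation.Nullary using (Dec; yes; no)
open import Relation.Binary.PropositionalEquality
  using (_≡_; refl; sym; trans; cong; subst; subst₂; _≢_; module ≡-Reasoning)
open import Function using (id; _∋_)
open import Function.Bundles using (_⇔_; Equivalence; mk⇔)

-- The order in which a σ-fixpoint is extremal: σ = true (μ) is the
-- usual order false ≤ true, σ = false (ν) is its dual.  In both cases
-- 'not σ' is the bottom and σ the top element.

_⊑⟨_⟩_ : Bool → Bool → Bool → Set
a ⊑⟨ true  ⟩ b = a ≤ᵇ b
a ⊑⟨ false ⟩ b = b ≤ᵇ a

⊑-reflexive : ∀ σ {a b} → a ≡ b → a ⊑⟨ σ ⟩ b
⊑-reflexive true  e = Boolₚ.≤-reflexive e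
⊑-reflexive false e = Boolₚ.≤-reflexive (sym e)

⊑-refl : ∀ σ {a} → a ⊑⟨ σ ⟩ a
⊑-refl σ = ⊑-reflexive σ refl

⊑-trans : ∀ σ {a b c} → a ⊑⟨ σ ⟩ b → b ⊑⟨ σ ⟩ c → a ⊑⟨ σ ⟩ c
⊑-trans true  p q = Boolₚ.≤-trans p q
⊑-trans false p q = Boolₚ.≤-trans q p

⊑-antisym : ∀ σ {a b} → a ⊑⟨ σ ⟩ b → b ⊑⟨ σ ⟩ a → a ≡ b
⊑-antisym true  p q = Boolₚ.≤-antisym p q
⊑-antisym false p q = Boolₚ.≤-antisym q p

⊑-bottom : ∀ σ a → not σ ⊑⟨ σ ⟩ a
⊑-bottom true  a = Boolₚ.≤-minimum a
⊑-bottom false a = Boolₚ.≤-maximum a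

⊑-top : ∀ σ {a} → σ ⊑⟨ σ ⟩ a → a ≡ σ
⊑-top true  b≤b = refl
⊑-top false b≤b = refl

bottom-or-top : ∀ σ a → a ≡ not σ ⊎ a ≡ σ
bottom-or-top true  false = inj₁ refl
bottom-or-top true  true  = inj₂ refl
bottom-or-top false false = inj₂ refl
bottom-or-top false true  = inj₁ refl

Pointwise : ∀ {n} → (Bool → Bool → Set) → Env n → Env n → Set
Pointwise R η η' = ∀ u → R (η u) (η' u)

_≐_ : ∀ {n} → Env n → Env n → Set
_≐_ = Pointwise _≡_

_⊑ₑ⟨_⟩_ : ∀ {n} → Env n → Bool → Env n → Set
η ⊑ₑ⟨ σ ⟩ η' = Pointwise (λ a b → a ⊑⟨ σ ⟩ b) η η'

⊑ₑ-reflexive : ∀ {n} σ {η η' : Env n} → η ≐ η' → η ⊑ₑ⟨ σ ⟩ η'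
⊑ₑ-reflexive σ p u = ⊑-reflexive σ (p u)

Monotone : ∀ {n} → (Env n → Env n) → Set
Monotone {n} F = ∀ {η η' : Env n} → Pointwise _≤ᵇ_ η η' → Pointwise _≤ᵇ_ (F η) (F η')

monotone-σ : ∀ {n} {F : Env n → Env n} → Monotone F →
             ∀ σ {η η'} → η ⊑ₑ⟨ σ ⟩ η' → F η ⊑ₑ⟨ σ ⟩ F η'
monotone-σ F-mono true  p = F-mono p
monotone-σ F-mono false p = F-mono p

monotone-ext : ∀ {n} {F : Env n → Env n} → Monotone F → ∀ {η η'} → η ≐ η' → F η ≐ F η'
monotone-ext F-mono p u =
  ⊑-antisym true (F-mono (⊑ₑ-reflexive true p) u) (F-mono (⊑ₑ-reflexive true (λ w → sym (p w))) u)

update-same : ∀ {n} (η : Env n) x b → (η [ x ≔ b ]) x ≡ b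
update-same η x b with x ≟F x
... | yes _  = refl
... | no x≢x = ⊥-elim (x≢x refl)

update-other : ∀ {n} (η : Env n) x b y → x ≢ y → (η [ x ≔ b ]) y ≡ η y
update-other η x b y x≢y with x ≟F y
... | yes x≡y = ⊥-elim (x≢y x≡y)
... | no _    = refl

update-rel : ∀ {n} (R : Bool → Bool → Set) {η η' : Env n} x {b b'} →
             Pointwise R η η' → R b b' → Pointwise R (η [ x ≔ b ]) (η' [ x ≔ b' ])
update-rel R x p q y with x ≟F y
... | yes _ = q
... | no _  = p y

_∈?_ : ∀ {n} (u : Fin n) (B : List (Fin n)) → Dec (u ∈ B)
u ∈? B = any? (u ≟F_) B

overlay : ∀ {n} → List (Fin n) → Env n → Env n → Env n
overlay B η ρ u with u ∈? B
... | yes _ = ρ u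
... | no _  = η u

overlay-in : ∀ {n} {B} (η ρ : Env n) {u} → u ∈ B → overlay B η ρ u ≡ ρ u
overlay-in {B = B} η ρ {u} u∈B with u ∈? B
... | yes _   = refl
... | no u∉B = ⊥-elim (u∉B u∈B)

overlay-out : ∀ {n} {B} (η ρ : Env n) {u} → u ∉ B → overlay B η ρ u ≡ η u
overlay-out {B = B} η ρ {u} u∉B with u ∈? B
... | yes u∈B = ⊥-elim (u∉B u∈B)
... | no _    = refl

overlay-rel : ∀ {n} (R : Bool → Bool → Set) B {η η' ρ ρ' : Env n} →
              Pointwise R η η' → (∀ u → u ∈ B → R (ρ u) (ρ' u)) →
              Pointwise R (overlay B η ρ) (overlay B η' ρ')
overlay-rel R B p q u with u ∈? B
... | yes u∈B = q u u∈B
... | no _    = p u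

-- It is bounded by n and grows along strict increases, so
-- an ascending chain in Bool^n stabilises after at most n steps.

atTop : Bool → Bool → ℕ
atTop true  true  = 1
atTop true  false = 0
atTop false true  = 0
atTop false false = 1

atTop-step : ∀ σ {a b} → a ⊑⟨ σ ⟩ b → a ≡ b ⊎ atTop σ a < atTop σ b
atTop-step true  b≤b = inj₁ refl
atTop-step true  f≤t = inj₂ (s≤s z≤n)
atTop-step false b≤b = inj₁ refl
atTop-step false f≤t = inj₂ (s≤s z≤n)

atTop≤1 : ∀ σ a → atTop σ a ≤ 1
atTop≤1 true  true  = s≤s z≤n
atTop≤1 true  false = z≤n
atTop≤1 false true  = z≤n
atTop≤1 false false = s≤s z≤n

height : ∀ {n} → Bool → Env n → ℕ
height {zero}  σ ρ = 0
height {suc n} σ ρ = atTop σ (ρ fzero) + height σ (λ i → ρ (fsuc i))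

height-bound : ∀ {n} σ (ρ : Env n) → height σ ρ ≤ n
height-bound {zero}  σ ρ = z≤n
height-bound {suc n} σ ρ = ℕₚ.+-mono-≤ (atTop≤1 σ (ρ fzero)) (height-bound σ (λ i → ρ (fsuc i)))

height-mono : ∀ {n} σ {ρ ρ' : Env n} → ρ ⊑ₑ⟨ σ ⟩ ρ' → height σ ρ ≤ height σ ρ'
height-mono {zero}  σ p = z≤n
height-mono {suc n} σ p with atTop-step σ (p fzero)
... | inj₁ e  rewrite e = ℕₚ.+-monoʳ-≤ _ (height-mono σ (λ i → p (fsuc i)))
... | inj₂ lt = ℕₚ.+-mono-≤ (ℕₚ.<⇒≤ lt) (height-mono σ (λ i → p (fsuc i)))

height-strict : ∀ {n} σ {ρ ρ' : Env n} → ρ ⊑ₑ⟨ σ ⟩ ρ' → ρ ≐ ρ' ⊎ height σ ρ < height σ ρ'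
height-strict {zero}  σ p = inj₁ (λ ())
height-strict {suc n} σ {ρ} {ρ'} p with atTop-step σ (p fzero) | height-strict σ (λ i → p (fsuc i))
... | inj₁ e  | inj₁ q = inj₁ λ { fzero → e ; (fsuc i) → q i }
... | inj₁ e  | inj₂ lt rewrite e = inj₂ (ℕₚ.+-monoʳ-< (atTop σ (ρ' fzero)) lt)
... | inj₂ lt | _ = inj₂ (ℕₚ.+-mono-<-≤ lt (height-mono σ (λ i → p (fsuc i))))

-- Kleene iteration: for a map f on Bool^n that is monotone in the
-- σ-order, the iterates of f from the bottom form an ascending chain
-- which is constant from step n+1 on; its limit is the σ-least fixpoint.

module Kleene {n : ℕ} (σ : Bool) (f : Env n → Env n)
              (f-mono : ∀ {ρ ρ'} → ρ ⊑ₑ⟨ σ ⟩ ρ' → f ρ ⊑ₑ⟨ σ ⟩ f ρ') where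

  f-ext : ∀ {ρ ρ'} → ρ ≐ ρ' → f ρ ≐ f ρ'
  f-ext p u = ⊑-antisym σ (f-mono (⊑ₑ-reflexive σ p) u) (f-mono (⊑ₑ-reflexive σ (λ w → sym (p w))) u)

  iterate : ℕ → Env n
  iterate zero    = λ _ → not σ
  iterate (suc k) = f (iterate k)

  iterate-ascending : ∀ k → iterate k ⊑ₑ⟨ σ ⟩ iterate (suc k)
  iterate-ascending zero    u = ⊑-bottom σ _
  iterate-ascending (suc k)   = f-mono (iterate-ascending k)

  iterate-progress : ∀ k → iterate k ≐ iterate (suc k) ⊎ k ≤ height σ (iterate k)
  iterate-progress zero = inj₂ z≤n
  iterate-progress (suc k) with iterate-progress k
  ... | inj₁ e  = inj₁ (f-ext e)
  ... | inj₂ le with height-strict σ (iterate-ascending k)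
  ...   | inj₁ e  = inj₁ (f-ext e)
  ...   | inj₂ lt = inj₂ (ℕₚ.<-≤-trans (s≤s le) lt)

  lfp : Env n
  lfp = iterate (suc n)

  lfp-fixed : lfp ≐ f lfp
  lfp-fixed with iterate-progress (suc n)
  ... | inj₁ e  = e
  ... | inj₂ le = ⊥-elim (ℕₚ.<-irrefl refl (ℕₚ.≤-trans le (height-bound σ lfp)))

  iterate-beyond : ∀ j → iterate (j + suc n) ≐ lfp
  iterate-beyond zero    u = refl
  iterate-beyond (suc j) u = trans (f-ext (iterate-beyond j) u) (sym (lfp-fixed u))

  lfp-least : ∀ ρ → f ρ ⊑ₑ⟨ σ ⟩ ρ → lfp ⊑ₑ⟨ σ ⟩ ρ
  lfp-least ρ pre = below (suc n)
    where
    below : ∀ k → iterate k ⊑ₑ⟨ σ ⟩ ρ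
    below zero    u = ⊑-bottom σ _
    below (suc k) u = ⊑-trans σ (f-mono (below k) u) (pre u)

-- An equation
-- list is read as in Sem.solve: (x , σ) ∷ es binds X_x by a σ-fixpoint
-- (true = μ, false = ν) around the solution of es.  solveThen es g
-- solves es and passes the resulting environment on to g.

module Nested {n : ℕ} (F : Env n → Env n) (F-mono : Monotone F) where

  solveThen : List (Fin n × Bool) → (Env n → Env n) → Env n → Env n
  solveThen []             g η = g η
  solveThen ((x , σ) ∷ es) g η =
    solveThen es g (η [ x ≔ F (solveThen es g (η [ x ≔ not σ ])) x ])

  solveThen-mono : ∀ es {g} → Monotone g → Monotone (solveThen es g)
  solveThen-mono []             g-mono p = g-mono p
  solveThen-mono ((x , σ) ∷ es) g-mono p =
    solveThen-mono es g-mono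
      (update-rel _≤ᵇ_ x p (F-mono (solveThen-mono es g-mono (update-rel _≤ᵇ_ x p b≤b)) x))

  solveThen-++ : ∀ A Rs {g} → Monotone g → ∀ η →
                 solveThen (A ++ Rs) g η ≐ solveThen A (solveThen Rs g) η
  solveThen-++ []            Rs g-mono η u = refl
  solveThen-++ ((x , σ) ∷ A) Rs g-mono η u =
    trans (solveThen-++ A Rs g-mono _ u)
          (monotone-ext (solveThen-mono A (solveThen-mono Rs g-mono))
             (update-rel _≡_ x (λ _ → refl)
                (monotone-ext F-mono (solveThen-++ A Rs g-mono (η [ x ≔ not σ ])) x)) u)

  module Block (σ : Bool) (g : Env n → Env n) (g-mono : Monotone g) where

    _⊑_ : Bool → Bool → Set
    a ⊑ b = a ⊑⟨ σ ⟩ b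

    G : Env n → Env n
    G η = F (g η)

    G-mono : ∀ {η η'} → η ⊑ₑ⟨ σ ⟩ η' → G η ⊑ₑ⟨ σ ⟩ G η'
    G-mono = monotone-σ (λ p → F-mono (g-mono p)) σ

    G-ext : ∀ {η η'} → η ≐ η' → G η ≐ G η'
    G-ext = monotone-ext (λ p → F-mono (g-mono p))

    g-ext : ∀ {η η'} → η ≐ η' → g η ≐ g η'
    g-ext = monotone-ext g-mono

    -- one round of simultaneous iteration on the block B, the other
    -- variables being fixed by η
    step : List (Fin n) → Env n → Env n → Env n
    step B η ρ = overlay B (λ _ → not σ) (G (overlay B η ρ))

    step-mono : ∀ B {η η' ρ ρ'} → η ⊑ₑ⟨ σ ⟩ η' → ρ ⊑ₑ⟨ σ ⟩ ρ' → step B η ρ ⊑ₑ⟨ σ ⟩ step B η' ρ'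
    step-mono B p q = overlay-rel _⊑_ B (λ _ → ⊑-refl σ) (λ u _ → G-mono (overlay-rel _⊑_ B p (λ w _ → q w)) u)

    module Iteration (B : List (Fin n)) (η : Env n) =
      Kleene σ (step B η) (step-mono B (λ _ → ⊑-refl σ))

    blockFix : List (Fin n) → Env n → Env n
    blockFix B η = Iteration.lfp B η

    blockFix-fixed : ∀ B η {u} → u ∈ B → blockFix B η u ≡ G (overlay B η (blockFix B η)) u
    blockFix-fixed B η u∈B = trans (Iteration.lfp-fixed B η _) (overlay-in _ _ u∈B)

    blockFix-least : ∀ B η ρ → (∀ u → u ∈ B → G (overlay B η ρ) u ⊑⟨ σ ⟩ ρ u) →
                     blockFix B η ⊑ₑ⟨ σ ⟩ ρ
    blockFix-least B η ρ pre = Iteration.lfp-least B η ρ step-pre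
      where
      step-pre : step B η ρ ⊑ₑ⟨ σ ⟩ ρ
      step-pre u with u ∈? B
      ... | yes u∈B = pre u u∈B
      ... | no _    = ⊑-bottom σ (ρ u)

    blockFix-mono : ∀ B {η η'} → η ⊑ₑ⟨ σ ⟩ η' → blockFix B η ⊑ₑ⟨ σ ⟩ blockFix B η'
    blockFix-mono B {η} {η'} p = blockFix-least B η (blockFix B η') λ u u∈B →
      ⊑-trans σ (G-mono (overlay-rel _⊑_ B p (λ _ _ → ⊑-refl σ)) u)
                (⊑-reflexive σ (sym (blockFix-fixed B η' u∈B)))

    -- Inductive step of Bekič's principle for the block x ∷ B':
    -- first solving B' with X_x as a parameter b, and then X_x, yields the
    -- simultaneous fixpoint S of x ∷ B'.
    module BekičStep (x : Fin n) (B' : List (Fin n)) (x∉B' : x ∉ B') (η : Env n) where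

      S : Env n
      S = blockFix (x ∷ B') η

      target : Env n
      target = overlay (x ∷ B') η S

      inner : Bool → Env n
      inner b = overlay B' (η [ x ≔ b ]) (blockFix B' (η [ x ≔ b ]))

      -- the value of X_x: on Bool one iteration from the bottom reaches the fixpoint
      b* : Bool
      b* = G (inner (not σ)) x

      inner-mono : ∀ {b b'} → b ⊑⟨ σ ⟩ b' → inner b ⊑ₑ⟨ σ ⟩ inner b'
      inner-mono p = overlay-rel _⊑_ B' (update-rel _⊑_ x (λ _ → ⊑-refl σ) p)
                       (λ w _ → blockFix-mono B' (update-rel _⊑_ x (λ _ → ⊑-refl σ) p) w)

      inner-at-x : ∀ b → inner b x ≡ b
      inner-at-x b = trans (overlay-out _ _ x∉B') (update-same η x b)

      outside : ∀ {u} → x ≢ u → u ∉ B' → u ∉ x ∷ B'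
      outside x≢u u∉B' (here u≡x)  = x≢u (sym u≡x)
      outside x≢u u∉B' (there u∈B') = u∉B' u∈B'

      data Position (u : Fin n) : Set where
        at-x      : x ≡ u → Position u
        in-B'     : u ∈ B' → Position u
        off-block : x ≢ u → u ∉ B' → Position u

      position : ∀ u → Position u
      position u with x ≟F u | u ∈? B'
      ... | yes x≡u | _        = at-x x≡u
      ... | no _    | yes u∈B' = in-B' u∈B'
      ... | no x≢u  | no u∉B'  = off-block x≢u u∉B'

      inner-outside : ∀ b → overlay (x ∷ B') η (inner b) ≐ inner b
      inner-outside b u with position u
      ... | at-x refl         = overlay-in η (inner b) (here refl)
      ... | in-B' u∈B'        = overlay-in η (inner b) (there u∈B')
      ... | off-block x≢u u∉B' =
        trans (overlay-out η (inner b) (outside x≢u u∉B'))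
              (sym (trans (overlay-out _ _ u∉B') (update-other η x b u x≢u)))

      b*-fixed : G (inner b*) x ≡ b*
      b*-fixed with bottom-or-top σ b*
      ... | inj₁ b*≡⊥ = cong (λ b → G (inner b) x) b*≡⊥
      ... | inj₂ b*≡⊤ = trans (⊑-top σ (subst (λ c → c ⊑⟨ σ ⟩ G (inner b*) x) b*≡⊤
                                 (G-mono (inner-mono (⊑-bottom σ b*)) x)))
                              (sym b*≡⊤)

      inner-solves : ∀ u → u ∈ x ∷ B' → G (overlay (x ∷ B') η (inner b*)) u ≡ inner b* u
      inner-solves u u∈B = trans (G-ext (inner-outside b*) u) (solves u u∈B)
        where
        solves : ∀ u → u ∈ x ∷ B' → G (inner b*) u ≡ inner b* u
        solves u (here refl)   = trans b*-fixed (sym (inner-at-x b*))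
        solves u (there u∈B') = sym (trans (overlay-in _ _ u∈B') (blockFix-fixed B' _ u∈B'))

      S-below-inner : S ⊑ₑ⟨ σ ⟩ inner b*
      S-below-inner = blockFix-least (x ∷ B') η (inner b*) (λ u u∈B → ⊑-reflexive σ (inner-solves u u∈B))

      target-split : overlay B' (η [ x ≔ S x ]) S ≐ target
      target-split u with position u
      ... | at-x refl =
        trans (overlay-out _ S x∉B') (trans (update-same η x (S x)) (sym (overlay-in η S {u = x} (here refl))))
      ... | in-B' u∈B' =
        trans (overlay-in _ S u∈B') (sym (overlay-in {B = x ∷ B'} η S (there u∈B')))
      ... | off-block x≢u u∉B' =
        trans (overlay-out _ S u∉B')
              (trans (update-other η x (S x) u x≢u) (sym (overlay-out {B = x ∷ B'} η S (outside x≢u u∉B'))))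

      blockFix-B'-below-S : blockFix B' (η [ x ≔ S x ]) ⊑ₑ⟨ σ ⟩ S
      blockFix-B'-below-S = blockFix-least B' _ S λ u u∈B' →
        ⊑-reflexive σ (trans (G-ext target-split u) (sym (blockFix-fixed (x ∷ B') η (there u∈B'))))

      inner-below-target : ∀ {b} → b ⊑⟨ σ ⟩ S x → inner b ⊑ₑ⟨ σ ⟩ target
      inner-below-target p u =
        ⊑-trans σ (inner-mono p u)
          (⊑-trans σ (overlay-rel _⊑_ B' (λ _ → ⊑-refl σ) (λ w _ → blockFix-B'-below-S w) u)
                     (⊑-reflexive σ (target-split u)))

      b*-below : b* ⊑⟨ σ ⟩ S x
      b*-below = ⊑-trans σ (G-mono (inner-below-target (⊑-bottom σ (S x))) x)
                           (⊑-reflexive σ (sym (blockFix-fixed (x ∷ B') η (here refl))))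

      inner-is-target : inner b* ≐ target
      inner-is-target u =
        ⊑-antisym σ (inner-below-target b*-below u)
          (⊑-trans σ (overlay-rel _⊑_ (x ∷ B') (λ _ → ⊑-refl σ) (λ w _ → S-below-inner w) u)
                     (⊑-reflexive σ (inner-outside b* u)))

    bekic : ∀ B → Unique B → ∀ η →
            solveThen (map (λ u → u , σ) B) g η ≐ g (overlay B η (blockFix B η))
    bekic []        []              η u = refl
    bekic (x ∷ B') (x∉B' ∷ unique) η u = begin
      solveThen es g (η [ x ≔ b₀ ]) u  ≡⟨ bekic B' unique _ u ⟩
      g (inner b₀) u                   ≡⟨ cong (λ b → g (inner b) u) b₀≡b* ⟩
      g (inner b*) u                   ≡⟨ g-ext inner-is-target u ⟩
      g target u                       ∎
      where
      open ≡-Reasoning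
      open BekičStep x B' (All¬⇒¬Any x∉B') η
      es = map (λ u → u , σ) B'
      b₀ = F (solveThen es g (η [ x ≔ not σ ])) x
      b₀≡b* : b₀ ≡ b*
      b₀≡b* = monotone-ext F-mono (bekic B' unique (η [ x ≔ not σ ])) x

module Transfer {n m : ℕ}
  (F₁ : Env n → Env n) (F₁-mono : Monotone F₁)
  (F₂ : Env m → Env m) (F₂-mono : Monotone F₂)
  (R : Fin n → Fin m → Set)
  (F-agree : ∀ {ξ ξ'} → (∀ u v → R u v → ξ u ≡ ξ' v) → ∀ u v → R u v → F₁ ξ u ≡ F₂ ξ' v)
  (sign : ℕ → Bool)
  (block₁ : ℕ → List (Fin n)) (block₂ : ℕ → List (Fin m))
  (unique₁ : ∀ k → Unique (block₁ k)) (unique₂ : ∀ k → Unique (block₂ k))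
  (blocks-agree : ∀ k u v → R u v → (u ∈ block₁ k) ⇔ (v ∈ block₂ k))
  where

  module N₁ = Nested F₁ F₁-mono
  module N₂ = Nested F₂ F₂-mono

  Agree : Env n → Env m → Set
  Agree ξ ξ' = ∀ u v → R u v → ξ u ≡ ξ' v

  levelEquations₁ : ℕ → List (Fin n × Bool)
  levelEquations₁ k = map (λ u → u , sign k) (block₁ k)

  levelEquations₂ : ℕ → List (Fin m × Bool)
  levelEquations₂ k = map (λ u → u , sign k) (block₂ k)

  levels₁ : List ℕ → Env n → Env n
  levels₁ ks = N₁.solveThen (concatMap levelEquations₁ ks) id

  levels₂ : List ℕ → Env m → Env m
  levels₂ ks = N₂.solveThen (concatMap levelEquations₂ ks) id

  overlays-agree : ∀ k {η η' ρ ρ'} → Agree η η' → Agree ρ ρ' →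
                   Agree (overlay (block₁ k) η ρ) (overlay (block₂ k) η' ρ')
  overlays-agree k a b u v r with u ∈? block₁ k | v ∈? block₂ k
  ... | yes _   | yes _   = b u v r
  ... | no _    | no _    = a u v r
  ... | yes u∈  | no v∉  = ⊥-elim (v∉ (Equivalence.to (blocks-agree k u v r) u∈))
  ... | no u∉   | yes v∈  = ⊥-elim (u∉ (Equivalence.from (blocks-agree k u v r) v∈))

  module BlockTransfer (k : ℕ)
    (g₁ : Env n → Env n) (g₁-mono : Monotone g₁) (g₂ : Env m → Env m) (g₂-mono : Monotone g₂)
    (g-agree : ∀ {ρ ρ'} → Agree ρ ρ' → Agree (g₁ ρ) (g₂ ρ')) where

    module B₁ = N₁.Block (sign k) g₁ g₁-mono
    module B₂ = N₂.Block (sign k) g₂ g₂-mono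

    iterates-agree : ∀ {η η'} → Agree η η' → ∀ j →
                     Agree (B₁.Iteration.iterate (block₁ k) η j) (B₂.Iteration.iterate (block₂ k) η' j)
    iterates-agree a zero    u v r = refl
    iterates-agree a (suc j) =
      overlays-agree k (λ _ _ _ → refl) (F-agree (g-agree (overlays-agree k a (iterates-agree a j))))

    blockFix-agree : ∀ {η η'} → Agree η η' → Agree (B₁.blockFix (block₁ k) η) (B₂.blockFix (block₂ k) η')
    blockFix-agree {η} {η'} a u v r = begin
      B₁.blockFix (block₁ k) η u                             ≡⟨ sym (It₁.iterate-beyond (suc m) u) ⟩
      It₁.iterate (suc m + suc n) u                          ≡⟨ iterates-agree a (suc m + suc n) u v r ⟩
      It₂.iterate (suc m + suc n) v                          ≡⟨ cong (λ j → It₂.iterate j v) (ℕₚ.+-comm (suc m) (suc n)) ⟩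
      It₂.iterate (suc n + suc m) v                          ≡⟨ It₂.iterate-beyond (suc n) v ⟩
      B₂.blockFix (block₂ k) η' v                            ∎
      where
      open ≡-Reasoning
      module It₁ = B₁.Iteration (block₁ k) η
      module It₂ = B₂.Iteration (block₂ k) η'

  levels-mono₁ : ∀ ks → Monotone (levels₁ ks)
  levels-mono₁ ks = N₁.solveThen-mono (concatMap levelEquations₁ ks) id

  levels-mono₂ : ∀ ks → Monotone (levels₂ ks)
  levels-mono₂ ks = N₂.solveThen-mono (concatMap levelEquations₂ ks) id

  -- by Bekič, each level is the simultaneous fixpoint of its block,
  -- and these agree by BlockTransfer
  levels-agree : ∀ ks {η η'} → Agree η η' → Agree (levels₁ ks η) (levels₂ ks η')
  levels-agree []       a = a
  levels-agree (k ∷ ks) {η} {η'} a u v r = begin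
    levels₁ (k ∷ ks) η u
      ≡⟨ N₁.solveThen-++ (levelEquations₁ k) (concatMap levelEquations₁ ks) id η u ⟩
    N₁.solveThen (levelEquations₁ k) (levels₁ ks) η u
      ≡⟨ B₁.bekic (block₁ k) (unique₁ k) η u ⟩
    levels₁ ks (overlay (block₁ k) η (B₁.blockFix (block₁ k) η)) u
      ≡⟨ levels-agree ks (overlays-agree k a (blockFix-agree a)) u v r ⟩
    levels₂ ks (overlay (block₂ k) η' (B₂.blockFix (block₂ k) η')) v
      ≡⟨ sym (B₂.bekic (block₂ k) (unique₂ k) η' v) ⟩
    N₂.solveThen (levelEquations₂ k) (levels₂ ks) η' v
      ≡⟨ sym (N₂.solveThen-++ (levelEquations₂ k) (concatMap levelEquations₂ ks) id η' v) ⟩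
    levels₂ (k ∷ ks) η' v ∎
    where
    open ≡-Reasoning
    open BlockTransfer k (levels₁ ks) (levels-mono₁ ks) (levels₂ ks) (levels-mono₂ ks) (levels-agree ks)

-- They
-- are monotone, and their value depends only on the set of argument values.

headOr : ∀ {A : Set} → (A → Bool) → List A → Bool
headOr p []      = false
headOr p (x ∷ _) = p x

combine : ∀ {A : Set} → Maybe Deco → (A → Bool) → List A → Bool
combine (just ▲) p xs = allL p xs
combine (just ▼) p xs = anyL p xs
combine _        p xs = headOr p xs

∧-mono : ∀ {a b c d} → a ≤ᵇ b → c ≤ᵇ d → (a ∧ c) ≤ᵇ (b ∧ d)
∧-mono {false} p q = Boolₚ.≤-minimum _
∧-mono {true} {true} p q = q

∨-mono : ∀ {a b c d} → a ≤ᵇ b → c ≤ᵇ d → (a ∨ c) ≤ᵇ (b ∨ d)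
∨-mono {false} {false} p q = q
∨-mono {false} {true}  p q = Boolₚ.≤-maximum _
∨-mono {true}  {true}  p q = b≤b

allL-mono : ∀ {A : Set} {p p' : A → Bool} → (∀ a → p a ≤ᵇ p' a) → ∀ xs → allL p xs ≤ᵇ allL p' xs
allL-mono h []       = b≤b
allL-mono h (x ∷ xs) = ∧-mono (h x) (allL-mono h xs)

anyL-mono : ∀ {A : Set} {p p' : A → Bool} → (∀ a → p a ≤ᵇ p' a) → ∀ xs → anyL p xs ≤ᵇ anyL p' xs
anyL-mono h []       = b≤b
anyL-mono h (x ∷ xs) = ∨-mono (h x) (anyL-mono h xs)

headOr-mono : ∀ {A : Set} {p p' : A → Bool} → (∀ a → p a ≤ᵇ p' a) → ∀ xs → headOr p xs ≤ᵇ headOr p' xs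
headOr-mono h []      = b≤b
headOr-mono h (x ∷ _) = h x

combine-mono : ∀ {A : Set} d {p p' : A → Bool} → (∀ a → p a ≤ᵇ p' a) →
               ∀ xs → combine d p xs ≤ᵇ combine d p' xs
combine-mono (just ▲)  = allL-mono
combine-mono (just ▼)  = anyL-mono
combine-mono (just ⊤ᵈ) = headOr-mono
combine-mono (just ⊥ᵈ) = headOr-mono
combine-mono nothing   = headOr-mono

bool-ext : ∀ {a b} → (a ≡ true → b ≡ true) → (b ≡ true → a ≡ true) → a ≡ b
bool-ext {false} {false} f g = refl
bool-ext {false} {true}  f g = g refl
bool-ext {true}          f g = sym (f refl)

∧-true : ∀ {a b} → (a ∧ b) ≡ true → a ≡ true × b ≡ true
∧-true {true} {true} e = refl , refl

allL-true⁻ : ∀ {A : Set} {p : A → Bool} xs {a} → allL p xs ≡ true → a ∈ xs → p a ≡ true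
allL-true⁻ (x ∷ xs) e (here refl) = proj₁ (∧-true e)
allL-true⁻ (x ∷ xs) e (there a∈)  = allL-true⁻ xs (proj₂ (∧-true e)) a∈

allL-true⁺ : ∀ {A : Set} {p : A → Bool} xs → (∀ a → a ∈ xs → p a ≡ true) → allL p xs ≡ true
allL-true⁺ []       h = refl
allL-true⁺ (x ∷ xs) h rewrite h x (here refl) = allL-true⁺ xs (λ a a∈ → h a (there a∈))

anyL-true⁻ : ∀ {A : Set} {p : A → Bool} xs → anyL p xs ≡ true → ∃ λ a → a ∈ xs × p a ≡ true
anyL-true⁻ {p = p} (x ∷ xs) e with p x in px
... | true  = x , here refl , px
... | false = let (a , a∈ , pa) = anyL-true⁻ xs e in a , there a∈ , pa

anyL-true⁺ : ∀ {A : Set} {p : A → Bool} xs {a} → a ∈ xs → p a ≡ true → anyL p xs ≡ true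
anyL-true⁺ (x ∷ xs) (here refl) pa rewrite pa = refl
anyL-true⁺ {p = p} (x ∷ xs) (there a∈) pa =
  trans (cong (p x ∨_) (anyL-true⁺ xs a∈ pa)) (Boolₚ.∨-zeroʳ (p x))

SameValues : ∀ {A B : Set} → (A → Bool) → (B → Bool) → List A → List B → Set
SameValues p p' xs ys = (∀ a → a ∈ xs → ∃ λ b → b ∈ ys × p a ≡ p' b)
                      × (∀ b → b ∈ ys → ∃ λ a → a ∈ xs × p a ≡ p' b)

allL-same : ∀ {A B : Set} {p : A → Bool} {p' : B → Bool} xs ys → SameValues p p' xs ys →
            allL p xs ≡ allL p' ys
allL-same xs ys (forth , back) = bool-ext
  (λ e → allL-true⁺ ys λ b b∈ → let (a , a∈ , q) = back b b∈ in trans (sym q) (allL-true⁻ xs e a∈))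
  (λ e → allL-true⁺ xs λ a a∈ → let (b , b∈ , q) = forth a a∈ in trans q (allL-true⁻ ys e b∈))

anyL-same : ∀ {A B : Set} {p : A → Bool} {p' : B → Bool} xs ys → SameValues p p' xs ys →
            anyL p xs ≡ anyL p' ys
anyL-same xs ys (forth , back) = bool-ext
  (λ e → let (a , a∈ , q) = anyL-true⁻ xs e ; (b , b∈ , q') = forth a a∈ in anyL-true⁺ ys b∈ (trans (sym q') q))
  (λ e → let (b , b∈ , q) = anyL-true⁻ ys e ; (a , a∈ , q') = back b b∈ in anyL-true⁺ xs a∈ (trans q' q))

-- for headOr the second list must consist of a single repeated element
headOr-same : ∀ {A B : Set} {p : A → Bool} {p' : B → Bool} xs ys → SameValues p p' xs ys →
              (∀ b b' → b ∈ ys → b' ∈ ys → b ≡ b') → headOr p xs ≡ headOr p' ys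
headOr-same []       []       _              _        = refl
headOr-same []       (b ∷ ys) (_ , back)     _        with back b (here refl)
... | (_ , () , _)
headOr-same (a ∷ xs) []       (forth , _)    _        with forth a (here refl)
... | (_ , () , _)
headOr-same (a ∷ xs) (b ∷ ys) (forth , _)    constant with forth a (here refl)
... | (b₀ , b₀∈ , q) = trans q (cong _ (constant b₀ b b₀∈ (here refl)))

NotAndOr : Maybe Deco → Set
NotAndOr d = d ≢ just ▲ × d ≢ just ▼

combine-same : ∀ {A B : Set} d {p : A → Bool} {p' : B → Bool} xs ys → SameValues p p' xs ys →
               (NotAndOr d → ∀ b b' → b ∈ ys → b' ∈ ys → b ≡ b') → combine d p xs ≡ combine d p' ys
combine-same (just ▲)  xs ys same _        = allL-same xs ys same
combine-same (just ▼)  xs ys same _        = anyL-same xs ys same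
combine-same (just ⊤ᵈ) xs ys same constant = headOr-same xs ys same (constant ((λ ()) , (λ ())))
combine-same (just ⊥ᵈ) xs ys same constant = headOr-same xs ys same (constant ((λ ()) , (λ ())))
combine-same nothing   xs ys same constant = headOr-same xs ys same (constant ((λ ()) , (λ ())))

atomValue : Maybe ℕ → Maybe Deco → Bool → Bool
atomValue (just _) d         b = b
atomValue nothing  (just ⊤ᵈ) b = true
atomValue nothing  (just ⊥ᵈ) b = false
atomValue nothing  _         b = b

atomValue-mono : ∀ r d {a b} → a ≤ᵇ b → atomValue r d a ≤ᵇ atomValue r d b
atomValue-mono (just _) d         p = p
atomValue-mono nothing  (just ▲)  p = p
atomValue-mono nothing  (just ▼)  p = p
atomValue-mono nothing  (just ⊤ᵈ) p = b≤b
atomValue-mono nothing  (just ⊥ᵈ) p = b≤b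
atomValue-mono nothing  nothing   p = p

isOdd : ℕ → Bool
isOdd zero          = false
isOdd (suc zero)    = true
isOdd (suc (suc k)) = isOdd k

≤-foldr-⊔ : ∀ {A : Set} (f : A → ℕ) xs {a} → a ∈ xs → f a ≤ foldr (λ a acc → f a ⊔ acc) 0 xs
≤-foldr-⊔ f (x ∷ xs) (here refl) = ℕₚ.m≤m⊔n (f x) _
≤-foldr-⊔ f (x ∷ xs) (there a∈) = ℕₚ.≤-trans (≤-foldr-⊔ f xs a∈) (ℕₚ.m≤n⊔m (f x) _)

module OnGraph {n : ℕ} (t : StructureGraph n) (ζ : Var → Bool)
               (bessy : BESsy t) (normalised : Normalised t) (noFree : NoFreeVars t) where

  open Sem t ζ using (vs; succs; φ-val; φ; rhs; hasRank; maxRank; odd; equations; solve)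

  -- an unranked vertex has no successor, hence is decorated neither ▲ nor ▼
  unranked-not-AndOr : ∀ u → rank t u ≡ nothing → NotAndOr (deco t u)
  unranked-not-AndOr u unranked = (λ d → no-succ (inj₁ (inj₁ d))) , (λ d → no-succ (inj₁ (inj₂ d)))
    where
    no-succ : ((deco t u ≡ just ▲ ⊎ deco t u ≡ just ▼) ⊎ Ranked t u) → ⊥
    no-succ h with subst Is-just unranked (normalised u (Equivalence.to (BESsy.succIff bessy u) h))
    ... | ()

  -- so φ(u) never unfolds a Conj/Disj: it is the atom of u
  φ-atom : ∀ k η u → φ-val k η u ≡ atomValue (rank t u) (deco t u) (η u)
  φ-atom k η u with rank t u in ranked
  ... | just _ = refl
  ... | nothing with deco t u in d
  ...   | just ▲  = ⊥-elim (proj₁ (unranked-not-AndOr u ranked) d)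
  ...   | just ▼  = ⊥-elim (proj₂ (unranked-not-AndOr u ranked) d)
  ...   | just ⊤ᵈ = refl
  ...   | just ⊥ᵈ = refl
  ...   | nothing rewrite noFree u = refl

  rhs-combine : ∀ η u → rhs η u ≡ combine (deco t u) (φ η) (succs u)
  rhs-combine η u with deco t u
  ... | just ▲ = refl
  ... | just ▼ = refl
  ... | just ⊤ᵈ with succs u
  ...   | []    = refl
  ...   | _ ∷ _ = refl
  rhs-combine η u | just ⊥ᵈ with succs u
  ...   | []    = refl
  ...   | _ ∷ _ = refl
  rhs-combine η u | nothing with succs u
  ...   | []    = refl
  ...   | _ ∷ _ = refl

  φ-mono : ∀ {η η'} → Pointwise _≤ᵇ_ η η' → ∀ u → φ η u ≤ᵇ φ η' u
  φ-mono {η} {η'} p u = subst₂ _≤ᵇ_ (sym (φ-atom n η u)) (sym (φ-atom n η' u))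
                          (atomValue-mono (rank t u) (deco t u) (p u))

  rhs-mono : Monotone rhs
  rhs-mono {η} {η'} p u = subst₂ _≤ᵇ_ (sym (rhs-combine η u)) (sym (rhs-combine η' u))
                            (combine-mono (deco t u) (φ-mono p) (succs u))

  ∈-succs⁻ : ∀ {u w} → w ∈ succs u → Edge t u w
  ∈-succs⁻ {u} w∈ = proj₂ (∈-filter⁻ (λ v → _ Bool.≟ true) {xs = vs} w∈)

  ∈-succs⁺ : ∀ {u w} → Edge t u w → w ∈ succs u
  ∈-succs⁺ {u} {w} e = ∈-filter⁺ (λ v → _ Bool.≟ true) (∈-allFin w) e

  succ-unique : ∀ u → NotAndOr (deco t u) → ∀ w w' → w ∈ succs u → w' ∈ succs u → w ≡ w'
  succ-unique u (not▲ , not▼) w w' w∈ w'∈ with w ≟F w'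
  ... | yes w≡w' = w≡w'
  ... | no w≢w' with BESsy.multi bessy u w w' (∈-succs⁻ w∈) (∈-succs⁻ w'∈) w≢w'
  ...   | inj₁ d = ⊥-elim (not▲ d)
  ...   | inj₂ d = ⊥-elim (not▼ d)

  hasRank? : ∀ k u → Dec (hasRank k u ≡ true)
  hasRank? k u = hasRank k u Bool.≟ true

  block : ℕ → List (Fin n)
  block k = filter (hasRank? k) vs

  hasRank⇔ : ∀ k u → hasRank k u ≡ true ⇔ rank t u ≡ just k
  hasRank⇔ k u with rank t u
  ... | nothing = mk⇔ (λ ()) (λ ())
  ... | just j with j ℕₚ.≟ k
  ...   | yes refl = mk⇔ (λ _ → refl) (λ _ → refl)
  ...   | no j≢k  = mk⇔ (λ ()) (λ { refl → ⊥-elim (j≢k refl) })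

  ∈-block : ∀ k u → u ∈ block k ⇔ rank t u ≡ just k
  ∈-block k u = mk⇔ (λ u∈ → Equivalence.to (hasRank⇔ k u) (proj₂ (∈-filter⁻ (hasRank? k) {xs = vs} u∈)))
                    (λ r → ∈-filter⁺ (hasRank? k) (∈-allFin u) (Equivalence.from (hasRank⇔ k u) r))

  block-unique : ∀ k → Unique (block k)
  block-unique k = Uniqueₚ.filter⁺ (hasRank? k) {xs = vs} (Uniqueₚ.allFin⁺ n)

  rank-bound : ∀ u {j} → rank t u ≡ just j → j ≤ maxRank
  rank-bound u {j} r with rank t u | r | (_ ≤ maxRank) ∋ ≤-foldr-⊔ _ vs (∈-allFin u)
  ... | just .j | refl | bound = bound

  block-empty : ∀ k → maxRank < k → block k ≡ []
  block-empty k M<k = Listₚ.filter-none (hasRank? k) (All.universal not-rank-k vs)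
    where
    not-rank-k : ∀ u → hasRank k u ≢ true
    not-rank-k u e = ℕₚ.<⇒≱ M<k (rank-bound u (Equivalence.to (hasRank⇔ k u) e))

  levelEquations : ℕ → List (Fin n × Bool)
  levelEquations k = map (λ u → u , isOdd k) (block k)

  odd≡isOdd : ∀ k → odd k ≡ isOdd k
  odd≡isOdd zero          = refl
  odd≡isOdd (suc zero)    = refl
  odd≡isOdd (suc (suc k)) = odd≡isOdd k

  equations-by-level : equations ≡ concatMap levelEquations (downFrom (suc maxRank))
  equations-by-level =
    trans (Listₚ.concatMap-cong (λ k → cong (λ s → map (λ u → u , s) (block k)) (odd≡isOdd k))
                                 (reverse (upTo (suc maxRank))))
          (cong (concatMap levelEquations) (Listₚ.reverse-upTo (suc maxRank)))

  levels-pad : ∀ K → maxRank ≤ K →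
               concatMap levelEquations (downFrom (suc K)) ≡ concatMap levelEquations (downFrom (suc maxRank))
  levels-pad K M≤K = subst (λ K → concatMap levelEquations (downFrom (suc K)) ≡ _)
                           (ℕₚ.m∸n+n≡m M≤K) (pad (K ∸ maxRank))
    where
    pad : ∀ d → concatMap levelEquations (downFrom (suc (d + maxRank)))
              ≡ concatMap levelEquations (downFrom (suc maxRank))
    pad zero    = refl
    pad (suc d) =
      trans (cong (λ B → map (λ u → u , isOdd (suc d + maxRank)) B
                          ++ concatMap levelEquations (downFrom (suc (d + maxRank))))
                  (block-empty (suc d + maxRank) (s≤s (ℕₚ.m≤n+m maxRank d))))
            (pad d)

  open Nested rhs rhs-mono public using (solveThen; solveThen-mono)

  solve-is-solveThen : ∀ es η → solve es η ≐ solveThen es id η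
  solve-is-solveThen []             η u = refl
  solve-is-solveThen ((x , σ) ∷ es) η u =
    trans (solve-is-solveThen es _ u)
          (monotone-ext (solveThen-mono es (λ p → p))
             (update-rel _≡_ x (λ _ → refl)
                (trans (fixpoint-at-bottom σ) (monotone-ext rhs-mono (solve-is-solveThen es _) x))) u)
    where
    fixpoint-at-bottom : ∀ σ {f : Bool → Bool} → (if σ then μfix else νfix) f ≡ f (not σ)
    fixpoint-at-bottom true  = refl
    fixpoint-at-bottom false = refl

  BES-by-levels : ∀ K → maxRank ≤ K → ∀ η →
                  Sem.⟦BES⟧ t ζ η ≐ solveThen (concatMap levelEquations (downFrom (suc K))) id η
  BES-by-levels K M≤K η u =
    trans (solve-is-solveThen equations η u)
          (cong (λ es → solveThen es id η u) (trans equations-by-level (sym (levels-pad K M≤K))))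

-- R-related vertices have
-- the same rank and decoration and R-matching successors, so φ and the
-- right-hand sides respect R, the rank blocks correspond, and by
-- Transfer the solutions of the two BESs agree on R-related vertices.

module BisimilarGraphs {n m : ℕ} (t : StructureGraph n) (t' : StructureGraph m) (ζ : Var → Bool)
  (bessy : BESsy t) (bessy' : BESsy t') (normalised : Normalised t) (normalised' : Normalised t')
  (noFree : NoFreeVars t) (noFree' : NoFreeVars t')
  (R : Fin n → Fin m → Set) (bisim : IsBisimulation t t' R) where

  module G₁ = OnGraph t ζ bessy normalised noFree
  module G₂ = OnGraph t' ζ bessy' normalised' noFree'

  deco-eq : ∀ {u v} → R u v → deco t u ≡ deco t' v
  deco-eq r = proj₁ (bisim _ _ r)

  rank-eq : ∀ {u v} → R u v → rank t u ≡ rank t' v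
  rank-eq r = proj₁ (proj₂ (bisim _ _ r))

  forth : ∀ {u v} → R u v → ∀ u' → Edge t u u' → ∃ λ v' → Edge t' v v' × R u' v'
  forth r = proj₁ (proj₂ (proj₂ (proj₂ (bisim _ _ r))))

  back : ∀ {u v} → R u v → ∀ v' → Edge t' v v' → ∃ λ u' → Edge t u u' × R u' v'
  back r = proj₂ (proj₂ (proj₂ (proj₂ (bisim _ _ r))))

  Agree : Env n → Env m → Set
  Agree ξ ξ' = ∀ u v → R u v → ξ u ≡ ξ' v

  φ-agree : ∀ {ξ ξ'} → Agree ξ ξ' → ∀ u v → R u v → Sem.φ t ζ ξ u ≡ Sem.φ t' ζ ξ' v
  φ-agree {ξ} {ξ'} a u v r = begin
    Sem.φ t ζ ξ u                                   ≡⟨ G₁.φ-atom n ξ u ⟩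
    atomValue (rank t u) (deco t u) (ξ u)           ≡⟨ cong (λ d → atomValue (rank t u) d (ξ u)) (deco-eq r) ⟩
    atomValue (rank t u) (deco t' v) (ξ u)          ≡⟨ cong (λ k → atomValue k (deco t' v) (ξ u)) (rank-eq r) ⟩
    atomValue (rank t' v) (deco t' v) (ξ u)         ≡⟨ cong (atomValue (rank t' v) (deco t' v)) (a u v r) ⟩
    atomValue (rank t' v) (deco t' v) (ξ' v)        ≡⟨ sym (G₂.φ-atom m ξ' v) ⟩
    Sem.φ t' ζ ξ' v                                 ∎
    where open ≡-Reasoning

  succs-same : ∀ {ξ ξ'} → Agree ξ ξ' → ∀ {u v} → R u v →
               SameValues (Sem.φ t ζ ξ) (Sem.φ t' ζ ξ') (Sem.succs t ζ u) (Sem.succs t' ζ v)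
  succs-same a r =
      (λ u' u'∈ → let (v' , e , r') = forth r u' (G₁.∈-succs⁻ u'∈) in v' , G₂.∈-succs⁺ e , φ-agree a u' v' r')
    , (λ v' v'∈ → let (u' , e , r') = back r v' (G₂.∈-succs⁻ v'∈) in u' , G₁.∈-succs⁺ e , φ-agree a u' v' r')

  rhs-agree : ∀ {ξ ξ'} → Agree ξ ξ' → Agree (Sem.rhs t ζ ξ) (Sem.rhs t' ζ ξ')
  rhs-agree {ξ} {ξ'} a u v r = begin
    Sem.rhs t ζ ξ u                                          ≡⟨ G₁.rhs-combine ξ u ⟩
    combine (deco t u) (Sem.φ t ζ ξ) (Sem.succs t ζ u)       ≡⟨ combine-same (deco t u) _ _ (succs-same a r) unique ⟩
    combine (deco t u) (Sem.φ t' ζ ξ') (Sem.succs t' ζ v)    ≡⟨ cong (λ d → combine d _ _) (deco-eq r) ⟩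
    combine (deco t' v) (Sem.φ t' ζ ξ') (Sem.succs t' ζ v)   ≡⟨ sym (G₂.rhs-combine ξ' v) ⟩
    Sem.rhs t' ζ ξ' v                                        ∎
    where
    open ≡-Reasoning
    unique : NotAndOr (deco t u) → ∀ w w' → w ∈ Sem.succs t' ζ v → w' ∈ Sem.succs t' ζ v → w ≡ w'
    unique notAndOr = G₂.succ-unique v (subst NotAndOr (deco-eq r) notAndOr)

  blocks-agree : ∀ k u v → R u v → (u ∈ G₁.block k) ⇔ (v ∈ G₂.block k)
  blocks-agree k u v r = mk⇔
    (λ u∈ → Equivalence.from (G₂.∈-block k v) (trans (sym (rank-eq r)) (Equivalence.to (G₁.∈-block k u) u∈)))
    (λ v∈ → Equivalence.from (G₁.∈-block k u) (trans (rank-eq r) (Equivalence.to (G₂.∈-block k v) v∈)))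

  open Transfer (Sem.rhs t ζ) G₁.rhs-mono (Sem.rhs t' ζ) G₂.rhs-mono R rhs-agree
                isOdd G₁.block G₂.block G₁.block-unique G₂.block-unique blocks-agree
    using (levels-agree)

  BES-agree : ∀ {η η'} → Agree η η' → Agree (Sem.⟦BES⟧ t ζ η) (Sem.⟦BES⟧ t' ζ η')
  BES-agree {η} {η'} a u v r = begin
    Sem.⟦BES⟧ t ζ η u                       ≡⟨ G₁.BES-by-levels K (ℕₚ.m≤m⊔n M₁ M₂) η u ⟩
    G₁.solveThen (levels G₁.levelEquations) id η u  ≡⟨ levels-agree (downFrom (suc K)) a u v r ⟩
    G₂.solveThen (levels G₂.levelEquations) id η' v ≡⟨ sym (G₂.BES-by-levels K (ℕₚ.m≤n⊔m M₁ M₂) η' v) ⟩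
    Sem.⟦BES⟧ t' ζ η' v                     ∎
    where
    open ≡-Reasoning
    M₁ M₂ K : ℕ
    M₁ = Sem.maxRank t ζ
    M₂ = Sem.maxRank t' ζ
    K  = M₁ ⊔ M₂
    levels : ∀ {k} → (ℕ → List (Fin k × Bool)) → List (Fin k × Bool)
    levels eqs = concatMap eqs (downFrom (suc K))

-- Lemma 5.7.

lemma5p7 : {n m : ℕ} (t : StructureGraph n) (t' : StructureGraph m) →
    BESsy t → BESsy t' → Normalised t → Normalised t' →
    NoFreeVars t → NoFreeVars t' → Minimal t →
    t ↔ t' → (ζ : Var → Bool) → ⟦φ⟧⟦BES⟧ t ζ ≡ ⟦φ⟧⟦BES⟧ t' ζ
lemma5p7 t t' bessy bessy' normalised normalised' noFree noFree' _ (R , bisim , roots) ζ =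
  φ-agree (BES-agree (λ _ _ _ → refl)) (root t) (root t') roots
  where
  open BisimilarGraphs t t' ζ bessy bessy' normalised normalised' noFree noFree' R bisim
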